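{- Let $q$ be a prime power and $T_1=\{A=(a_{ij})\in UU_4(\mathbb{F}_q)\mid a_{34}=0\}$. Then $T_1$ is an AC-group and $\omega(T_1)=q^2+1$.
   Context: $UU_4(\mathbb{F}_q)$ is the group of $4\times 4$ upper triangular matrices over $\mathbb{F}_q$ with diagonal entries $1$; $T_1$ is a subgroup. A group is an AC-group if the centralizer of every non-central element is abelian. A subset is non-commuting if any two distinct elements do not commute; $\omega(A)$ is the maximum cardinality of a non-commuting subset of $A$. -}

module Defs where

open import Level using (Level; _⊔_)
open import Data.Nat using (ℕ; _≤_; _<_)
open import Data.Fin using (Fin; toℕ; zero; suc)
open import Data.List using (List; length; lookup)
open import Data.List.Relation.Unary.All using (All)
open import Data.Product using (Σ; _×_)
open import Relation.Nullary using (¬_)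
open import Relation.Binary.PropositionalEquality using (_≡_; _≢_)
import Relation.Binary.PropositionalEquality as ≡
open import Algebra.Bundles using (CommutativeRing)
open import Function.Bundles using (Inverse)

record IsField {c ℓ : Level} (R : CommutativeRing c ℓ) : Set (c ⊔ ℓ) where
  open CommutativeRing R hiding (zero)
  field
    0≉1 : ¬ (0# ≈ 1#)
    inverse : ∀ x → ¬ (x ≈ 0#) → Σ Carrier (λ y → (x * y) ≈ 1#)

HasCard : {c ℓ : Level} (R : CommutativeRing c ℓ) → ℕ → Set (c ⊔ ℓ)
HasCard R q = Inverse (CommutativeRing.setoid R) (≡.setoid (Fin q))

module Matrices {c ℓ : Level} (R : CommutativeRing c ℓ) where
  open CommutativeRing R hiding (zero)

  -- 4×4 matrices over R (indices 0..3, so entry a_ij of the paper is M (i-1) (j-1)).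
  Mat : Set c
  Mat = Fin 4 → Fin 4 → Carrier

  _≋_ : Mat → Mat → Set ℓ
  A ≋ B = ∀ i j → A i j ≈ B i j

  sum4 : (Fin 4 → Carrier) → Carrier
  sum4 f = f zero + (f (suc zero) + (f (suc (suc zero)) + f (suc (suc (suc zero)))))

  _⊗_ : Mat → Mat → Mat
  (A ⊗ B) i j = sum4 (λ k → A i k * B k j)

  i1 i2 i3 i4 : Fin 4
  i1 = zero
  i2 = suc zero
  i3 = suc (suc zero)
  i4 = suc (suc (suc zero))

  InUU4 : Mat → Set ℓ
  InUU4 M = (∀ i j → toℕ j < toℕ i → M i j ≈ 0#) × (∀ i → M i i ≈ 1#)

  InT1 : Mat → Set ℓ
  InT1 M = InUU4 M × (M i3 i4 ≈ 0#)

  Commute : Mat → Mat → Set ℓ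
  Commute A B = (A ⊗ B) ≋ (B ⊗ A)

  module _ {p : Level} (G : Mat → Set p) where
    Central : Mat → Set (c ⊔ ℓ ⊔ p)
    Central A = ∀ B → G B → Commute A B

    IsACGroup : Set (c ⊔ ℓ ⊔ p)
    IsACGroup = ∀ A → G A → ¬ Central A →
                ∀ B C → G B → G C → Commute A B → Commute A C → Commute B C

    -- A list of elements of G, pairwise (at distinct positions) non-commuting.
    -- (Such a list has no repetitions, since every element commutes with itself,
    -- so it is exactly a non-commuting subset.)
    NonCommuting : List Mat → Set (c ⊔ ℓ ⊔ p)
    NonCommuting xs = All G xs ×
      (∀ (i j : Fin (length xs)) → i ≢ j → ¬ Commute (lookup xs i) (lookup xs j))

    ωIs : ℕ → Set (c ⊔ ℓ ⊔ p)
    ωIs n = Σ (List Mat) (λ xs → NonCommuting xs × length xs ≡ n)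
          × (∀ xs → NonCommuting xs → length xs ≤ n)

module Submission where

open import Defs
open import Level using (Level)
open import Algebra.Bundles using (CommutativeRing)
open import Data.Nat as ℕ using (ℕ; _≤_)
open import Data.Fin using (Fin; zero; suc; toℕ; cast; splitAt; join; remQuot; combine; _≟_)
open import Data.Fin.Properties
  using (splitAt-join; join-splitAt; remQuot-combine; combine-remQuot; cast-involutive; injective⇒≤)
open import Data.Product using (_×_; _,_; proj₁; proj₂; uncurry)
open import Data.Sum using (_⊎_; inj₁; inj₂; map₁)
open import Data.Sum.Properties using (inj₁-injective)
open import Data.List using (length; lookup; tabulate)
open import Data.List.Properties using (length-tabulate; lookup-tabulate)
import Data.List.Relation.Unary.All as All
open import Data.List.Relation.Unary.All.Properties using (tabulate⁺)
open import Data.List.Membership.Propositional.Properties using (∈-lookup)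
open import Data.Empty using (⊥-elim)
open import Data.Vec.N-ary using (N-ary)
open import Relation.Nullary using (¬_; Dec; yes; no)
open import Relation.Nullary.Decidable using (via-injection)
open import Relation.Binary.PropositionalEquality as ≡ using (_≡_; _≢_)
open import Function.Bundles using (Inverse; Injection; Equivalence; _⇔_; mk⇔)
open import Function.Properties.Inverse using (Inverse⇒Injection)

-- An element of T₁ is determined by its five free entries, and the product
-- formula shows that A, B ∈ T₁ commute iff their "linking data"
-- (α, β, γ) = (a₁₂, a₂₃, a₂₄) satisfy  α_A β_B = α_B β_A  and  α_A γ_B = α_B γ_A.
-- Over a field this relation is transitive through every pivot A whose data is
-- not identically zero, and A is central when its data vanishes: so T₁ is an
-- AC-group.  For ω, the data of A is sorted into q² + 1 classes — the "slope"
-- (β/α, γ/α) ∈ F² if α ≠ 0 and a single class ∞ if α = 0 — and members of one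
-- class commute, so a non-commuting set has at most q² + 1 elements; one
-- representative per class gives a non-commuting set of exactly that size.

pattern #1 = zero
pattern #2 = suc #1
pattern #3 = suc #2
pattern #4 = suc #3

module NonCommutingSets {c ℓ : Level} (F : CommutativeRing c ℓ) where
  open Matrices F

  module _ {p : Level} (G : Mat → Set p) {m : ℕ} where

    nonCommuting-length≤ : (κ : Mat → Fin m) →
                           (∀ {A B} → G A → G B → κ A ≡ κ B → Commute A B) →
                           ∀ xs → NonCommuting G xs → length xs ≤ m
    nonCommuting-length≤ κ sameClass⇒commute xs (xs⊆G , noncomm) =
      injective⇒≤ {f = λ i → κ (lookup xs i)} classes-distinct
      where
      classes-distinct : ∀ {i j} → κ (lookup xs i) ≡ κ (lookup xs j) → i ≡ j
      classes-distinct {i} {j} same with i ≟ j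
      ... | yes i≡j = i≡j
      ... | no i≢j = ⊥-elim (noncomm i j i≢j
              (sameClass⇒commute (All.lookup xs⊆G (∈-lookup i)) (All.lookup xs⊆G (∈-lookup j)) same))

    tabulate-nonCommuting : (g : Fin m → Mat) → (∀ k → G (g k)) →
                            (∀ k k' → Commute (g k) (g k') → k ≡ k') →
                            NonCommuting G (tabulate g) × length (tabulate g) ≡ m
    tabulate-nonCommuting g g∈G commute⇒≡ =
      (tabulate⁺ g∈G , noncomm) , length-tabulate g
      where
      index : Fin (length (tabulate g)) → Fin m
      index = cast (length-tabulate g)

      position : Fin m → Fin (length (tabulate g))
      position = cast (≡.sym (length-tabulate g))

      position-index : ∀ i → position (index i) ≡ i
      position-index = cast-involutive (≡.sym (length-tabulate g)) (length-tabulate g)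

      lookup≡g : ∀ i → lookup (tabulate g) i ≡ g (index i)
      lookup≡g i = ≡.trans (≡.cong (lookup (tabulate g)) (≡.sym (position-index i)))
                           (lookup-tabulate g (index i))

      noncomm : ∀ i j → i ≢ j → ¬ Commute (lookup (tabulate g) i) (lookup (tabulate g) j)
      noncomm i j i≢j comm = i≢j (begin
        i                  ≡⟨ ≡.sym (position-index i) ⟩
        position (index i) ≡⟨ ≡.cong position (commute⇒≡ _ _ comm') ⟩
        position (index j) ≡⟨ position-index j ⟩
        j                  ∎)
        where
        open ≡.≡-Reasoning
        comm' : Commute (g (index i)) (g (index j))
        comm' = ≡.subst₂ Commute (lookup≡g i) (lookup≡g j) comm

    ωIs-byClasses : (κ : Mat → Fin m) →
                    (∀ {A B} → G A → G B → κ A ≡ κ B → Commute A B) →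
                    (g : Fin m → Mat) → (∀ k → G (g k)) →
                    (∀ k k' → Commute (g k) (g k') → k ≡ k') →
                    ωIs G m
    ωIs-byClasses κ sameClass⇒commute g g∈G commute⇒≡ =
      (tabulate g , tabulate-nonCommuting g g∈G commute⇒≡) ,
      nonCommuting-length≤ κ sameClass⇒commute

module Parallelism {c ℓ : Level} (F : CommutativeRing c ℓ) where
  open CommutativeRing F hiding (zero)
  open import Relation.Binary.Reasoning.Setoid setoid
  import Algebra.Solver.Ring.NaturalCoefficients.Default commutativeSemiring as Solver
  open Solver using (solve; _:=_; _:*_)

  infix 4 _∥_
  _∥_ : Carrier × Carrier → Carrier × Carrier → Set ℓ
  (a , x) ∥ (a' , x') = a * x' ≈ a' * x

  vertical-∥ : ∀ {a x a' x'} → a ≈ 0# → a' ≈ 0# → (a , x) ∥ (a' , x')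
  vertical-∥ {a} {x} {a'} {x'} a≈0 a'≈0 = begin
    a * x'  ≈⟨ *-congʳ a≈0 ⟩
    0# * x' ≈⟨ zeroˡ x' ⟩
    0#      ≈⟨ sym (zeroˡ x) ⟩
    0# * x  ≈⟨ *-congʳ (sym a'≈0) ⟩
    a' * x  ∎

  zero-∥ : ∀ {a x a' x'} → a ≈ 0# → x ≈ 0# → (a , x) ∥ (a' , x')
  zero-∥ {a} {x} {a'} {x'} a≈0 x≈0 = begin
    a * x'  ≈⟨ *-congʳ a≈0 ⟩
    0# * x' ≈⟨ zeroˡ x' ⟩
    0#      ≈⟨ sym (zeroʳ a') ⟩
    a' * 0# ≈⟨ *-congˡ (sym x≈0) ⟩
    a' * x  ∎

  sameSlope-∥ : ∀ {a x a' x'} u u' → a * u ≈ 1# → a' * u' ≈ 1# → x * u ≈ x' * u' → (a , x) ∥ (a' , x')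
  sameSlope-∥ {a} {x} {a'} {x'} u u' au≈1 a'u'≈1 slopes = begin
    a * x'                 ≈⟨ sym (*-identityʳ _) ⟩
    (a * x') * 1#          ≈⟨ *-congˡ (sym a'u'≈1) ⟩
    (a * x') * (a' * u')   ≈⟨ solve 4 (λ a x' a' u' → (a :* x') :* (a' :* u') := (a :* a') :* (x' :* u')) refl a x' a' u' ⟩
    (a * a') * (x' * u')   ≈⟨ *-congˡ (sym slopes) ⟩
    (a * a') * (x * u)     ≈⟨ solve 4 (λ a a' x u → (a :* a') :* (x :* u) := (a' :* x) :* (a :* u)) refl a a' x u ⟩
    (a' * x) * (a * u)     ≈⟨ *-congˡ au≈1 ⟩
    (a' * x) * 1#          ≈⟨ *-identityʳ _ ⟩
    a' * x                 ∎

  module OverField (isField : IsField F) where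
    open IsField isField

    cancel-nonzero : ∀ {x y z} → ¬ (x ≈ 0#) → x * y ≈ x * z → y ≈ z
    cancel-nonzero {x} {y} {z} x≉0 xy≈xz = begin
      y             ≈⟨ sym (*-identityˡ y) ⟩
      1# * y        ≈⟨ *-congʳ (sym xu≈1) ⟩
      (x * u) * y   ≈⟨ solve 3 (λ x u y → (x :* u) :* y := u :* (x :* y)) refl x u y ⟩
      u * (x * y)   ≈⟨ *-congˡ xy≈xz ⟩
      u * (x * z)   ≈⟨ solve 3 (λ x u z → u :* (x :* z) := (x :* u) :* z) refl x u z ⟩
      (x * u) * z   ≈⟨ *-congʳ xu≈1 ⟩
      1# * z        ≈⟨ *-identityˡ z ⟩
      z             ∎
      where
      u : Carrier
      u = proj₁ (inverse x x≉0)
      xu≈1 : x * u ≈ 1#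
      xu≈1 = proj₂ (inverse x x≉0)

    ∥-trans-via : ∀ {a x a₁ x₁ a₂ x₂} → ¬ (a ≈ 0#) →
                  (a , x) ∥ (a₁ , x₁) → (a , x) ∥ (a₂ , x₂) → (a₁ , x₁) ∥ (a₂ , x₂)
    ∥-trans-via {a} {x} {a₁} {x₁} {a₂} {x₂} a≉0 ax₁≈a₁x ax₂≈a₂x = cancel-nonzero a≉0 (begin
      a * (a₁ * x₂) ≈⟨ solve 3 (λ a a₁ x₂ → a :* (a₁ :* x₂) := a₁ :* (a :* x₂)) refl a a₁ x₂ ⟩
      a₁ * (a * x₂) ≈⟨ *-congˡ ax₂≈a₂x ⟩
      a₁ * (a₂ * x) ≈⟨ solve 3 (λ a₁ a₂ x → a₁ :* (a₂ :* x) := a₂ :* (a₁ :* x)) refl a₁ a₂ x ⟩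
      a₂ * (a₁ * x) ≈⟨ *-congˡ (sym ax₁≈a₁x) ⟩
      a₂ * (a * x₁) ≈⟨ solve 3 (λ a a₂ x₁ → a₂ :* (a :* x₁) := a :* (a₂ :* x₁)) refl a a₂ x₁ ⟩
      a * (a₂ * x₁) ∎)

    ∥-vertical : ∀ {a x a' x'} → a ≈ 0# → ¬ (x ≈ 0#) → (a , x) ∥ (a' , x') → a' ≈ 0#
    ∥-vertical {a} {x} {a'} {x'} a≈0 x≉0 ax'≈a'x = cancel-nonzero x≉0 (begin
      x * a'  ≈⟨ *-comm x a' ⟩
      a' * x  ≈⟨ sym ax'≈a'x ⟩
      a * x'  ≈⟨ *-congʳ a≈0 ⟩
      0# * x' ≈⟨ zeroˡ x' ⟩
      0#      ≈⟨ sym (zeroʳ x) ⟩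
      x * 0#  ∎)

-- The shape of an element of T₁ with free entries a₁₂ a₁₃ a₁₄ a₂₃ a₂₄, over any type
-- with a chosen zero and one (used for ring elements and for formal polynomials).
t1Shape : ∀ {a} {A : Set a} (zero one a₁₂ a₁₃ a₁₄ a₂₃ a₂₄ : A) → Fin 4 → Fin 4 → A
t1Shape z o a₁₂ a₁₃ a₁₄ a₂₃ a₂₄ #1 #1 = o
t1Shape z o a₁₂ a₁₃ a₁₄ a₂₃ a₂₄ #1 #2 = a₁₂
t1Shape z o a₁₂ a₁₃ a₁₄ a₂₃ a₂₄ #1 #3 = a₁₃
t1Shape z o a₁₂ a₁₃ a₁₄ a₂₃ a₂₄ #1 #4 = a₁₄
t1Shape z o a₁₂ a₁₃ a₁₄ a₂₃ a₂₄ #2 #2 = o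
t1Shape z o a₁₂ a₁₃ a₁₄ a₂₃ a₂₄ #2 #3 = a₂₃
t1Shape z o a₁₂ a₁₃ a₁₄ a₂₃ a₂₄ #2 #4 = a₂₄
t1Shape z o a₁₂ a₁₃ a₁₄ a₂₃ a₂₄ #3 #3 = o
t1Shape z o a₁₂ a₁₃ a₁₄ a₂₃ a₂₄ #4 #4 = o
t1Shape z o a₁₂ a₁₃ a₁₄ a₂₃ a₂₄ _  _  = z

module T1Coordinates {c ℓ : Level} (F : CommutativeRing c ℓ) where
  open CommutativeRing F hiding (zero)
  open Matrices F
  open Parallelism F using (_∥_)
  import Algebra.Solver.Ring.NaturalCoefficients.Default commutativeSemiring as Solver
  open Solver using (solve; Polynomial; _:=_; _:+_; _:*_; con)
  open import Algebra.Properties.Group +-group using (∙-cancelˡ)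

  mk : (a₁₂ a₁₃ a₁₄ a₂₃ a₂₄ : Carrier) → Mat
  mk = t1Shape 0# 1#

  mk∈T1 : ∀ a₁₂ a₁₃ a₁₄ a₂₃ a₂₄ → InT1 (mk a₁₂ a₁₃ a₁₄ a₂₃ a₂₄)
  mk∈T1 a₁₂ a₁₃ a₁₄ a₂₃ a₂₄ = (belowDiagonal , diagonal) , refl
    where
    belowDiagonal : ∀ i j → toℕ j ℕ.< toℕ i → mk a₁₂ a₁₃ a₁₄ a₂₃ a₂₄ i j ≈ 0#
    belowDiagonal #1 j ()
    belowDiagonal #2 #1 _ = refl
    belowDiagonal #3 #1 _ = refl
    belowDiagonal #3 #2 _ = refl
    belowDiagonal #4 #1 _ = refl
    belowDiagonal #4 #2 _ = refl
    belowDiagonal #4 #3 _ = refl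
    belowDiagonal #2 (suc j) (ℕ.s≤s ())
    belowDiagonal #3 (suc (suc j)) (ℕ.s≤s (ℕ.s≤s ()))
    belowDiagonal #4 (suc (suc (suc j))) (ℕ.s≤s (ℕ.s≤s (ℕ.s≤s ())))
    diagonal : ∀ i → mk a₁₂ a₁₃ a₁₄ a₂₃ a₂₄ i i ≈ 1#
    diagonal #1 = refl
    diagonal #2 = refl
    diagonal #3 = refl
    diagonal #4 = refl

  -- mk respects the ring equality; needed because sums in the product formula
  -- only agree up to commutativity of +.
  mk-cong : ∀ {a b d e f a' b' d' e' f'} → a ≈ a' → b ≈ b' → d ≈ d' → e ≈ e' → f ≈ f' →
            mk a b d e f ≋ mk a' b' d' e' f'
  mk-cong a≈ b≈ d≈ e≈ f≈ #1 #1 = refl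
  mk-cong a≈ b≈ d≈ e≈ f≈ #1 #2 = a≈
  mk-cong a≈ b≈ d≈ e≈ f≈ #1 #3 = b≈
  mk-cong a≈ b≈ d≈ e≈ f≈ #1 #4 = d≈
  mk-cong a≈ b≈ d≈ e≈ f≈ #2 #1 = refl
  mk-cong a≈ b≈ d≈ e≈ f≈ #2 #2 = refl
  mk-cong a≈ b≈ d≈ e≈ f≈ #2 #3 = e≈
  mk-cong a≈ b≈ d≈ e≈ f≈ #2 #4 = f≈
  mk-cong a≈ b≈ d≈ e≈ f≈ #3 #1 = refl
  mk-cong a≈ b≈ d≈ e≈ f≈ #3 #2 = refl
  mk-cong a≈ b≈ d≈ e≈ f≈ #3 #3 = refl
  mk-cong a≈ b≈ d≈ e≈ f≈ #3 #4 = refl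
  mk-cong a≈ b≈ d≈ e≈ f≈ #4 #1 = refl
  mk-cong a≈ b≈ d≈ e≈ f≈ #4 #2 = refl
  mk-cong a≈ b≈ d≈ e≈ f≈ #4 #3 = refl
  mk-cong a≈ b≈ d≈ e≈ f≈ #4 #4 = refl

  T1≋mk : ∀ {A} → InT1 A → A ≋ mk (A i1 i2) (A i1 i3) (A i1 i4) (A i2 i3) (A i2 i4)
  T1≋mk {A} ((lower , diagonal) , a₃₄≈0) = entry
    where
    entry : A ≋ mk (A i1 i2) (A i1 i3) (A i1 i4) (A i2 i3) (A i2 i4)
    entry #1 #1 = diagonal #1
    entry #1 #2 = refl
    entry #1 #3 = refl
    entry #1 #4 = refl
    entry #2 #1 = lower #2 #1 (ℕ.s≤s ℕ.z≤n)
    entry #2 #2 = diagonal #2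
    entry #2 #3 = refl
    entry #2 #4 = refl
    entry #3 #1 = lower #3 #1 (ℕ.s≤s ℕ.z≤n)
    entry #3 #2 = lower #3 #2 (ℕ.s≤s (ℕ.s≤s ℕ.z≤n))
    entry #3 #3 = diagonal #3
    entry #3 #4 = a₃₄≈0
    entry #4 #1 = lower #4 #1 (ℕ.s≤s ℕ.z≤n)
    entry #4 #2 = lower #4 #2 (ℕ.s≤s (ℕ.s≤s ℕ.z≤n))
    entry #4 #3 = lower #4 #3 (ℕ.s≤s (ℕ.s≤s (ℕ.s≤s ℕ.z≤n)))
    entry #4 #4 = diagonal #4

  ⊗-cong : ∀ {A A' B B'} → A ≋ A' → B ≋ B' → (A ⊗ B) ≋ (A' ⊗ B')
  ⊗-cong A≋ B≋ i j = +-cong (*-cong (A≋ i #1) (B≋ #1 j)) (+-cong (*-cong (A≋ i #2) (B≋ #2 j))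
                       (+-cong (*-cong (A≋ i #3) (B≋ #3 j)) (*-cong (A≋ i #4) (B≋ #4 j))))

  Commute-resp : ∀ {A A' B B'} → A ≋ A' → B ≋ B' → Commute A' B' → Commute A B
  Commute-resp A≋ B≋ comm i j = trans (⊗-cong A≋ B≋ i j) (trans (comm i j) (sym (⊗-cong B≋ A≋ i j)))

  product-identity : Fin 4 → Fin 4 → N-ary 10 (Polynomial 10) (Polynomial 10 × Polynomial 10)
  product-identity i j a b d e f a' b' d' e' f' =
    sum (λ k → shape a b d e f i k :* shape a' b' d' e' f' k j)
      := shape (a :+ a') (b :+ b' :+ a :* e') (d :+ d' :+ a :* f') (e :+ e') (f :+ f') i j
    where
    shape : (a₁₂ a₁₃ a₁₄ a₂₃ a₂₄ : Polynomial 10) → Fin 4 → Fin 4 → Polynomial 10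
    shape = t1Shape (con 0) (con 1)
    sum : (Fin 4 → Polynomial 10) → Polynomial 10
    sum g = g #1 :+ (g #2 :+ (g #3 :+ g #4))

  product-formula : ∀ a b d e f a' b' d' e' f' →
    (mk a b d e f ⊗ mk a' b' d' e' f') ≋ mk (a + a') (b + b' + a * e') (d + d' + a * f') (e + e') (f + f')
  product-formula a b d e f a' b' d' e' f' i j = entry i j a b d e f a' b' d' e' f'
    where
    entry : ∀ i j a b d e f a' b' d' e' f' →
      (mk a b d e f ⊗ mk a' b' d' e' f') i j ≈ mk (a + a') (b + b' + a * e') (d + d' + a * f') (e + e') (f + f') i j
    entry #1 #1 = solve 10 (product-identity #1 #1) refl
    entry #1 #2 = solve 10 (product-identity #1 #2) refl
    entry #1 #3 = solve 10 (product-identity #1 #3) refl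
    entry #1 #4 = solve 10 (product-identity #1 #4) refl
    entry #2 #1 = solve 10 (product-identity #2 #1) refl
    entry #2 #2 = solve 10 (product-identity #2 #2) refl
    entry #2 #3 = solve 10 (product-identity #2 #3) refl
    entry #2 #4 = solve 10 (product-identity #2 #4) refl
    entry #3 #1 = solve 10 (product-identity #3 #1) refl
    entry #3 #2 = solve 10 (product-identity #3 #2) refl
    entry #3 #3 = solve 10 (product-identity #3 #3) refl
    entry #3 #4 = solve 10 (product-identity #3 #4) refl
    entry #4 #1 = solve 10 (product-identity #4 #1) refl
    entry #4 #2 = solve 10 (product-identity #4 #2) refl
    entry #4 #3 = solve 10 (product-identity #4 #3) refl
    entry #4 #4 = solve 10 (product-identity #4 #4) refl

  -- Two elements of the form mk commute iff the cross terms of the product formula agree.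
  mk-commute⇔ : ∀ {a b d e f a' b' d' e' f'} →
    Commute (mk a b d e f) (mk a' b' d' e' f') ⇔ ((a , e) ∥ (a' , e') × (a , f) ∥ (a' , f'))
  mk-commute⇔ {a} {b} {d} {e} {f} {a'} {b'} {d'} {e'} {f'} = mk⇔ commute⇒∥ ∥⇒commute
    where
    AB BA : Mat
    AB = mk (a + a') (b + b' + a * e') (d + d' + a * f') (e + e') (f + f')
    BA = mk (a' + a) (b' + b + a' * e) (d' + d + a' * f) (e' + e) (f' + f)

    commute⇔sums : Commute (mk a b d e f) (mk a' b' d' e' f') ⇔ AB ≋ BA
    commute⇔sums = mk⇔
      (λ comm i j → trans (sym (product-formula a b d e f a' b' d' e' f' i j))
                      (trans (comm i j) (product-formula a' b' d' e' f' a b d e f i j)))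
      (λ AB≋BA i j → trans (product-formula a b d e f a' b' d' e' f' i j)
                      (trans (AB≋BA i j) (sym (product-formula a' b' d' e' f' a b d e f i j))))

    cancel-sum : ∀ {x x' y y'} → x + x' + y ≈ x' + x + y' → y ≈ y'
    cancel-sum {x} {x'} {y} {y'} eq = ∙-cancelˡ (x + x') y y' (trans eq (+-congʳ (+-comm x' x)))

    commute⇒∥ : Commute (mk a b d e f) (mk a' b' d' e' f') → (a , e) ∥ (a' , e') × (a , f) ∥ (a' , f')
    commute⇒∥ comm = cancel-sum (AB≋BA #1 #3) , cancel-sum (AB≋BA #1 #4)
      where
      AB≋BA : AB ≋ BA
      AB≋BA = Equivalence.to commute⇔sums comm

    ∥⇒commute : (a , e) ∥ (a' , e') × (a , f) ∥ (a' , f') → Commute (mk a b d e f) (mk a' b' d' e' f')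
    ∥⇒commute (ae'≈a'e , af'≈a'f) = Equivalence.from commute⇔sums
      (mk-cong (+-comm a a') (+-cong (+-comm b b') ae'≈a'e) (+-cong (+-comm d d') af'≈a'f)
               (+-comm e e') (+-comm f f'))

  α β γ : Mat → Carrier
  α A = A i1 i2
  β A = A i2 i3
  γ A = A i2 i4

  Linked : Mat → Mat → Set ℓ
  Linked A B = (α A , β A) ∥ (α B , β B) × (α A , γ A) ∥ (α B , γ B)

  T1-commute⇔linked : ∀ {A B} → InT1 A → InT1 B → Commute A B ⇔ Linked A B
  T1-commute⇔linked A∈T1 B∈T1 = mk⇔
    (λ comm → Equivalence.to mk-commute⇔ (Commute-resp (≋-sym (T1≋mk A∈T1)) (≋-sym (T1≋mk B∈T1)) comm))
    (λ linked → Commute-resp (T1≋mk A∈T1) (T1≋mk B∈T1) (Equivalence.from mk-commute⇔ linked))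
    where
    ≋-sym : ∀ {A B} → A ≋ B → B ≋ A
    ≋-sym A≋B i j = sym (A≋B i j)

module ACProperty {c ℓ : Level} (F : CommutativeRing c ℓ) (isField : IsField F)
                  (≈0? : ∀ x → Dec (CommutativeRing._≈_ F x (CommutativeRing.0# F))) where
  open CommutativeRing F hiding (zero)
  open Matrices F
  open Parallelism F
  open Parallelism.OverField F isField
  open T1Coordinates F

  Vanishing : Mat → Set ℓ
  Vanishing A = α A ≈ 0# × β A ≈ 0# × γ A ≈ 0#

  vanishing⇒central : ∀ {A} → InT1 A → Vanishing A → Central InT1 A
  vanishing⇒central A∈T1 (α≈0 , β≈0 , γ≈0) D D∈T1 =
    Equivalence.from (T1-commute⇔linked A∈T1 D∈T1) (zero-∥ α≈0 β≈0 , zero-∥ α≈0 γ≈0)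

  both-vertical : ∀ {B C} → α B ≈ 0# → α C ≈ 0# → Linked B C
  both-vertical αB≈0 αC≈0 = vertical-∥ αB≈0 αC≈0 , vertical-∥ αB≈0 αC≈0

  linked-through : ∀ {A B C} → ¬ Vanishing A → Linked A B → Linked A C → Linked B C
  linked-through {A} {B} {C} nonvanishing (βB , γB) (βC , γC) with ≈0? (α A) | ≈0? (β A) | ≈0? (γ A)
  ... | no α≉0  | _       | _       = ∥-trans-via α≉0 βB βC , ∥-trans-via α≉0 γB γC
  ... | yes α≈0 | no β≉0  | _       = both-vertical {B} {C} (∥-vertical α≈0 β≉0 βB) (∥-vertical α≈0 β≉0 βC)
  ... | yes α≈0 | yes _   | no γ≉0  = both-vertical {B} {C} (∥-vertical α≈0 γ≉0 γB) (∥-vertical α≈0 γ≉0 γC)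
  ... | yes α≈0 | yes β≈0 | yes γ≈0 = ⊥-elim (nonvanishing (α≈0 , β≈0 , γ≈0))

  -- A non-central A has non-vanishing linking data, so its centralizer is linked
  -- pairwise, i.e. abelian.
  T1-isAC : IsACGroup InT1
  T1-isAC A A∈T1 noncentral B C B∈T1 C∈T1 AB AC = Equivalence.from (T1-commute⇔linked B∈T1 C∈T1)
    (linked-through {A} {B} {C} (λ vanishing → noncentral (vanishing⇒central A∈T1 vanishing))
      (Equivalence.to (T1-commute⇔linked A∈T1 B∈T1) AB)
      (Equivalence.to (T1-commute⇔linked A∈T1 C∈T1) AC))

module SlopeClasses {c ℓ : Level} (F : CommutativeRing c ℓ) (isField : IsField F)
                    (q : ℕ) (card : HasCard F q) where
  open CommutativeRing F hiding (zero)
  open IsField isField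
  open Matrices F
  open Parallelism F
  open T1Coordinates F
  open NonCommutingSets F
  open Inverse card using (to; from; to-cong; strictlyInverseˡ)
  open Injection (Inverse⇒Injection card) using () renaming (injective to to-injective)

  _≈?_ : ∀ x y → Dec (x ≈ y)
  _≈?_ = via-injection (Inverse⇒Injection card) _≟_

  from-injective : ∀ {s t} → from s ≈ from t → s ≡ t
  from-injective {s} {t} eq = ≡.trans (≡.sym (strictlyInverseˡ s)) (≡.trans (to-cong eq) (strictlyInverseˡ t))

  -- A class is a slope in F² (coded in Fin q × Fin q) or the vertical class ∞.
  Class : Set
  Class = (Fin q × Fin q) ⊎ Fin 1

  toCodes : Class → Fin (q ℕ.* q) ⊎ Fin 1
  toCodes = map₁ (uncurry combine)

  fromCodes : Fin (q ℕ.* q) ⊎ Fin 1 → Class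
  fromCodes = map₁ (remQuot q)

  fromCodes-toCodes : ∀ u → fromCodes (toCodes u) ≡ u
  fromCodes-toCodes (inj₁ (s , t)) = ≡.cong inj₁ (remQuot-combine s t)
  fromCodes-toCodes (inj₂ ∞)       = ≡.refl

  toCodes-fromCodes : ∀ v → toCodes (fromCodes v) ≡ v
  toCodes-fromCodes (inj₁ m) = ≡.cong inj₁ (combine-remQuot {q} q m)
  toCodes-fromCodes (inj₂ ∞) = ≡.refl

  encode : Class → Fin (q ℕ.* q ℕ.+ 1)
  encode u = join (q ℕ.* q) 1 (toCodes u)

  decode : Fin (q ℕ.* q ℕ.+ 1) → Class
  decode k = fromCodes (splitAt (q ℕ.* q) k)

  decode-encode : ∀ u → decode (encode u) ≡ u
  decode-encode u = ≡.trans (≡.cong fromCodes (splitAt-join (q ℕ.* q) 1 (toCodes u))) (fromCodes-toCodes u)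

  encode-decode : ∀ k → encode (decode k) ≡ k
  encode-decode k =
    ≡.trans (≡.cong (join (q ℕ.* q) 1) (toCodes-fromCodes (splitAt (q ℕ.* q) k))) (join-splitAt (q ℕ.* q) 1 k)

  slope : (a x y : Carrier) → Dec (a ≈ 0#) → Class
  slope a x y (yes a≈0) = inj₂ zero
  slope a x y (no a≉0)  = inj₁ (to (x * a⁻¹) , to (y * a⁻¹))
    where
    a⁻¹ : Carrier
    a⁻¹ = proj₁ (inverse a a≉0)

  sameSlope⇒∥ : ∀ {a x y a' x' y'} (a≈0? : Dec (a ≈ 0#)) (a'≈0? : Dec (a' ≈ 0#)) →
                slope a x y a≈0? ≡ slope a' x' y' a'≈0? → (a , x) ∥ (a' , x') × (a , y) ∥ (a' , y')
  sameSlope⇒∥ (yes a≈0) (yes a'≈0) _ = vertical-∥ a≈0 a'≈0 , vertical-∥ a≈0 a'≈0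
  sameSlope⇒∥ (yes a≈0) (no a'≉0)  ()
  sameSlope⇒∥ (no a≉0)  (yes a'≈0) ()
  sameSlope⇒∥ {a} {x} {y} {a'} {x'} {y'} (no a≉0) (no a'≉0) same =
    sameSlope-∥ u u' au≈1 a'u'≈1 (to-injective (≡.cong proj₁ codes)) ,
    sameSlope-∥ u u' au≈1 a'u'≈1 (to-injective (≡.cong proj₂ codes))
    where
    u u' : Carrier
    u = proj₁ (inverse a a≉0)
    u' = proj₁ (inverse a' a'≉0)
    au≈1 : a * u ≈ 1#
    au≈1 = proj₂ (inverse a a≉0)
    a'u'≈1 : a' * u' ≈ 1#
    a'u'≈1 = proj₂ (inverse a' a'≉0)
    codes : (to (x * u) , to (y * u)) ≡ (to (x' * u') , to (y' * u'))
    codes = inj₁-injective same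

  class : Mat → Class
  class A = slope (α A) (β A) (γ A) (α A ≈? 0#)

  sameClass⇒commute : ∀ {A B} → InT1 A → InT1 B → encode (class A) ≡ encode (class B) → Commute A B
  sameClass⇒commute {A} {B} A∈T1 B∈T1 same = Equivalence.from (T1-commute⇔linked A∈T1 B∈T1)
    (sameSlope⇒∥ (α A ≈? 0#) (α B ≈? 0#)
      (≡.trans (≡.sym (decode-encode (class A))) (≡.trans (≡.cong decode same) (decode-encode (class B)))))

  representative : Class → Mat
  representative (inj₁ (s , t)) = mk 1# 0# 0# (from s) (from t)
  representative (inj₂ ∞)       = mk 0# 0# 0# 1# 0#

  representative∈T1 : ∀ u → InT1 (representative u)
  representative∈T1 (inj₁ (s , t)) = mk∈T1 _ _ _ _ _
  representative∈T1 (inj₂ ∞)       = mk∈T1 _ _ _ _ _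

  representatives-noncommuting : ∀ u v → Commute (representative u) (representative v) → u ≡ v
  representatives-noncommuting u v comm =
    distinct u v (Equivalence.to (T1-commute⇔linked (representative∈T1 u) (representative∈T1 v)) comm)
    where
    1≉0 : ¬ (1# ≈ 0#)
    1≉0 1≈0 = 0≉1 (sym 1≈0)

    distinct : ∀ u v → Linked (representative u) (representative v) → u ≡ v
    distinct (inj₁ (s , t)) (inj₁ (s' , t')) (s∥s' , t∥t')
      with from-injective (trans (sym (*-identityˡ _)) (trans s∥s' (*-identityˡ _)))
         | from-injective (trans (sym (*-identityˡ _)) (trans t∥t' (*-identityˡ _)))
    ... | ≡.refl | ≡.refl = ≡.refl
    distinct (inj₁ _) (inj₂ _) (s∥∞ , _) = ⊥-elim (1≉0 (trans (sym (*-identityˡ _)) (trans s∥∞ (zeroˡ _))))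
    distinct (inj₂ _) (inj₁ _) (∞∥s , _) = ⊥-elim (0≉1 (trans (sym (zeroˡ _)) (trans ∞∥s (*-identityˡ _))))
    distinct (inj₂ zero) (inj₂ zero) _ = ≡.refl

  T1-ω : ωIs InT1 (q ℕ.* q ℕ.+ 1)
  T1-ω = ωIs-byClasses InT1 (λ A → encode (class A)) sameClass⇒commute
           (λ k → representative (decode k)) (λ k → representative∈T1 (decode k))
           (λ k k' comm → ≡.trans (≡.sym (encode-decode k))
              (≡.trans (≡.cong encode (representatives-noncommuting (decode k) (decode k') comm)) (encode-decode k')))

-- ℕ arithmetic is opened only here, since the modules above use the ring's _+_ and _*_.
open import Data.Nat using (_+_; _*_)

lemma4p4 : {c ℓ : Level} (F : CommutativeRing c ℓ) → IsField F →
    (q : ℕ) → HasCard F q →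
    Matrices.IsACGroup F (Matrices.InT1 F) × Matrices.ωIs F (Matrices.InT1 F) (q * q + 1)
lemma4p4 F isField q card = T1-isAC , T1-ω
  where
  open SlopeClasses F isField q card using (_≈?_; T1-ω)
  open ACProperty F isField (λ x → x ≈? CommutativeRing.0# F) using (T1-isAC)
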